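{- Let $H$ be a finite graph and $r,s\ge1$ integers. If $J$ is a cautious $(r,s)$-protocol that clears $H$, then $$width(J)\ge \left\lceil\frac{1+pw(H)}{r+s}\right\rceil.$$
   Context: Discrete-time immunization model. Fix integers $r,s\ge 1$ and a finite graph $H$. An $(r,s)$-protocol for $H$ is a finite sequence $J=(A_1,\dots,A_N)$ of subsets of $V(H)$ ($A_t$ is the set of vertices immunized at time-step $t$); $width(J)=\max_i|A_i|$. At time-step $0$ every vertex is red. For each $t\ge 1$ every vertex lies in exactly one of $G_t^r,\dots,G_t^1$ (green), $Y_t^s,\dots,Y_t^1$ (yellow), $R_t$ (red), determined as follows: if $v\in A_t$ then $v\in G_t^r$. If $v\notin A_t$: if $v$ was red at time $t-1$ or $v\in Y_{t-1}^1$, then $v\in R_t$; if $v\in Y_{t-1}^i$ with $2\le i\le s$, then $v\in Y_t^{i-1}$; if $v\in G_{t-1}^i$ with $2\le i\le r$, then $v\in G_t^{i-1}$; if $v\in G_{t-1}^1$ and $v$ has a neighbor in $R_t$, then $v\in Y_t^s$; otherwise $v\in G_t^1$. The protocol clears $H$ if all vertices are green at time-step $N$. An $(r,s)$-protocol that clears $H$ is cautious if for every vertex $w$: if the first immunization set containing $w$ is $A_j$ and the last is $A_k$, then among any $r+s$ consecutive members of $A_j,\dots,A_k$, at least one contains $w$. A path decomposition of $H$ is a sequence $(B_1,\dots,B_m)$ of subsets of $V(H)$ such that every edge has both ends in some $B_i$, and for every vertex $w$ the indices $i$ with $w\in B_i$ form a consecutive interval; its width is $\max_i|B_i|-1$,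 and $pw(H)$ is the minimum width of a path decomposition of $H$. -}

module Defs where

open import Data.Bool using (Bool; true; false; if_then_else_; not; _∧_; _∨_)
open import Data.Nat using (ℕ; zero; suc; _+_; _∸_; _≤_; _<_; _⊔_; _/_)
open import Data.Fin using (Fin; toℕ)
open import Data.Fin.Subset using (Subset; _∈_; _∉_; ∣_∣)
open import Data.Vec using (lookup)
open import Data.List using (List; foldr; foldl; map; tabulate; allFin)
open import Data.Bool.ListAction using (any)
open import Data.Unit using (⊤)
open import Data.Empty using (⊥)
open import Data.Integer using (ℤ; +_; _-_; _≤_)
open import Data.Product using (Σ; ∃; _×_)
open import Relation.Binary.PropositionalEquality using (_≡_)
open import Relation.Nullary using (¬_)

record Graph : Set where
  field
    n      : ℕ
    Adj    : Fin n → Fin n → Bool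
    sym    : ∀ u v → Adj u v ≡ true → Adj v u ≡ true
    irrefl : ∀ v → Adj v v ≡ false
open Graph public

-- A sequence (B_1,…,B_m), m ≥ 1, represented as  Fin (suc m') → Subset n.
record PathDecomposition (H : Graph) : Set where
  field
    m'   : ℕ
    bag  : Fin (suc m') → Subset (n H)
    edgeCovered : ∀ u v → Adj H u v ≡ true →
                  ∃ λ i → (u ∈ bag i) × (v ∈ bag i)
    consecutive : ∀ (w : Fin (n H)) (i j k : Fin (suc m')) →
                  toℕ i Data.Nat.≤ toℕ j → toℕ j Data.Nat.≤ toℕ k →
                  w ∈ bag i → w ∈ bag k → w ∈ bag j
open PathDecomposition public

maxBag : ∀ {H} → PathDecomposition H → ℕ
maxBag D = foldr _⊔_ 0 (map ∣_∣ (tabulate (bag D)))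

-- width = max_i |B_i| - 1   (an integer; it is -1 for all-empty bags)
pdWidth : ∀ {H} → PathDecomposition H → ℤ
pdWidth D = + maxBag D - + 1

IsPathwidth : Graph → ℤ → Set
IsPathwidth H p =
  (∃ λ (D : PathDecomposition H) → pdWidth D ≡ p) ×
  (∀ (D : PathDecomposition H) → p Data.Integer.≤ pdWidth D)

record Protocol (n : ℕ) : Set where
  field
    N : ℕ
    A : Fin N → Subset n     -- A (i) is the paper's A_{i+1}
open Protocol public

protocolWidth : ∀ {n} → Protocol n → ℕ
protocolWidth J = foldr _⊔_ 0 (map ∣_∣ (tabulate (A J)))

data Status : Set where
  green  : ℕ → Status
  yellow : ℕ → Status
  red    : Status

isGreen : Status → Set
isGreen (green _) = ⊤
isGreen _         = ⊥

becomesRed : ∀ {n} → Subset n → (Fin n → Status) → Fin n → Bool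
becomesRed A prev v with lookup A v
... | true = false
... | false with prev v
...   | red = true
...   | yellow 1 = true
...   | _ = false

step : (r s : ℕ) (H : Graph) → Subset (n H) → (Fin (n H) → Status) → Fin (n H) → Status
step r s H A prev v with lookup A v
... | true = green r
... | false with prev v
...   | red = red
...   | yellow 1 = red
...   | yellow (suc (suc i)) = yellow (suc i)
...   | green (suc (suc i)) = green (suc i)
...   | green 1 = if any (λ u → Adj H v u ∧ becomesRed A prev u) (allFin (n H))
                   then yellow s else green 1
-- the following statuses (G^0, Y^0) never occur; they are kept unchanged
...   | yellow 0 = yellow 0
...   | green 0 = green 0

finalStatus : (r s : ℕ) (H : Graph) → Protocol (n H) → Fin (n H) → Status
finalStatus r s H J = foldl (λ st X → step r s H X st) (λ _ → red) (tabulate (A J))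

Clears : (r s : ℕ) (H : Graph) → Protocol (n H) → Set
Clears r s H J = ∀ v → isGreen (finalStatus r s H J v)

IsFirst : ∀ {n} (J : Protocol n) → Fin n → Fin (N J) → Set
IsFirst J w j = w ∈ A J j × (∀ i → toℕ i Data.Nat.< toℕ j → w ∉ A J i)

IsLast : ∀ {n} (J : Protocol n) → Fin n → Fin (N J) → Set
IsLast J w k = w ∈ A J k × (∀ i → toℕ k Data.Nat.< toℕ i → w ∉ A J i)

Cautious : (r s : ℕ) (H : Graph) → Protocol (n H) → Set
Cautious r s H J =
  Clears r s H J ×
  (∀ (w : Fin (n H)) (j k : Fin (N J)) → IsFirst J w j → IsLast J w k →
     ∀ (t : ℕ) → toℕ j Data.Nat.≤ t → t + (r + s) Data.Nat.≤ suc (toℕ k) →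
     ∃ λ (i : Fin (N J)) → t Data.Nat.≤ toℕ i × toℕ i Data.Nat.< t + (r + s) × w ∈ A J i)

-- ⌈ a / b ⌉ for b ≥ 1 (value at b = 0 irrelevant)
ceilDiv : ℕ → ℕ → ℕ
ceilDiv a zero = 0
ceilDiv a (suc b) = (a + b) / suc b

-- A vertex w belongs to the bag B_t when it is immunized at some step before t + r + s and at
-- some step from t on. Adjacent vertices then share a bag: if v were first immunized more than r
-- steps after the last immunization of its neighbour u, the timer of u would reach G¹ next to the
-- red v, u would turn yellow and, never immunized again, could not be green at the end. Since a
-- cautious protocol immunizes every member of B_t during the r + s steps t, …, t + r + s − 1, we
-- get |B_t| ≤ (r + s) · width(J), so 1 + pw(H) ≤ (r + s) · width(J).

module Submission where

open import Defs
open import Data.Nat using (ℕ; _≤_; _+_)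
open import Data.Integer using (ℤ; ∣_∣; 1ℤ)
open import Data.Integer as ℤ using ()

open import Data.Bool using (Bool; true; false; _∧_)
open import Data.Bool.Properties using (¬-not; T-≡)
open import Data.Bool.ListAction using (any)
open import Data.Empty using (⊥-elim)
open import Data.Fin using (Fin; toℕ; fromℕ<) renaming (zero to fzero; suc to fsuc)
open import Data.Fin.Properties using (toℕ<n; toℕ-fromℕ<; fromℕ<-toℕ)
open import Data.Fin.Subset using (Subset; _∈_; _∉_; _∪_; _∩_; _⊆_)
  renaming (⊥ to ∅; ∣_∣ to size)
open import Data.Fin.Subset.Properties
  using (_∈?_; ∉⊥; ∣⊥∣≡0; x∈p∪q⁺; x∈p∪q⁻; x∈p∩q⁺; x∈p∩q⁻; p⊆q⇒∣p∣≤∣q∣)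
open import Data.List using (foldr; foldl; map; tabulate; allFin)
open import Data.List.Membership.Propositional using (lose)
open import Data.List.Membership.Propositional.Properties using (∈-allFin)
open import Data.List.Relation.Unary.Any.Properties using (any⁺)
open import Data.Nat using (zero; suc; _<_; _∸_; _*_; _⊔_; _⊓_; z≤n; s≤s; z<s; _<?_; _≤?_)
open import Data.Nat.DivMod using (m<n*o⇒m/o<n)
open import Data.Nat.Properties
open import Data.Product using (∃; ∃₂; _×_; _,_; proj₁; proj₂)
open import Data.Sum using (inj₁; inj₂)
open import Data.Vec using (_∷_; []; lookup)
open import Data.Vec.Properties using (lookup⇒[]=; []=⇒lookup)
open import Function using (_∘_; Equivalence)
open import Relation.Binary.PropositionalEquality as ≡ using (_≡_; refl; cong; cong₂; subst; trans)
open import Relation.Nullary using (¬_; yes; no)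
open import Relation.Unary using (Pred; Decidable)

∣p∪q∣≤∣p∣+∣q∣ : ∀ {m} (p q : Subset m) → size (p ∪ q) ≤ size p + size q
∣p∪q∣≤∣p∣+∣q∣ []          []          = z≤n
∣p∪q∣≤∣p∣+∣q∣ (true ∷ p)  (true ∷ q)  =
  s≤s (≤-trans (∣p∪q∣≤∣p∣+∣q∣ p q) (+-monoʳ-≤ (size p) (n≤1+n (size q))))
∣p∪q∣≤∣p∣+∣q∣ (true ∷ p)  (false ∷ q) = s≤s (∣p∪q∣≤∣p∣+∣q∣ p q)
∣p∪q∣≤∣p∣+∣q∣ (false ∷ p) (true ∷ q)  =
  ≤-trans (s≤s (∣p∪q∣≤∣p∣+∣q∣ p q)) (≤-reflexive (≡.sym (+-suc (size p) (size q))))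
∣p∪q∣≤∣p∣+∣q∣ (false ∷ p) (false ∷ q) = ∣p∪q∣≤∣p∣+∣q∣ p q

∉⇒lookup≡false : ∀ {m} {x : Fin m} {p : Subset m} → x ∉ p → lookup p x ≡ false
∉⇒lookup≡false {x = x} {p} x∉p = ¬-not {y = true} (x∉p ∘ lookup⇒[]= x p)

any-allFin : ∀ {m} (f : Fin m → Bool) {x} → f x ≡ true → any f (allFin m) ≡ true
any-allFin f {x} fx≡true =
  Equivalence.to T-≡ (any⁺ f (lose (∈-allFin x) (Equivalence.from T-≡ fx≡true)))

tabulate-⊔-upperBound : ∀ {A : Set} {m} (g : A → ℕ) (f : Fin m → A) i →
                        g (f i) ≤ foldr _⊔_ 0 (map g (tabulate f))
tabulate-⊔-upperBound g f fzero    = m≤m⊔n _ _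
tabulate-⊔-upperBound g f (fsuc i) =
  ≤-trans (tabulate-⊔-upperBound g (f ∘ fsuc) i) (m≤n⊔m _ _)

tabulate-⊔-lub : ∀ {A : Set} {m b} (g : A → ℕ) (f : Fin m → A) →
                 (∀ i → g (f i) ≤ b) → foldr _⊔_ 0 (map g (tabulate f)) ≤ b
tabulate-⊔-lub {m = zero}  g f bounded = z≤n
tabulate-⊔-lub {m = suc m} g f bounded =
  ⊔-lub (bounded fzero) (tabulate-⊔-lub g (f ∘ fsuc) (bounded ∘ fsuc))

least-witness : ∀ {ℓ} {P : Pred ℕ ℓ} → Decidable P → ∀ {n} → P n →
                ∃ λ j → P j × (∀ i → i < j → ¬ P i)
least-witness P? {n} Pn with P? 0
... | yes P0 = 0 , P0 , λ _ ()
least-witness P? {zero}  P0 | no ¬P0 = ⊥-elim (¬P0 P0)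
least-witness P? {suc n} Pn | no ¬P0 with least-witness (P? ∘ suc) Pn
... | j , Pj , below = suc j , Pj , λ { zero _ → ¬P0 ; (suc i) (s≤s i<j) → below i i<j }

greatest-witness : ∀ {ℓ} {P : Pred ℕ ℓ} → Decidable P → ∀ b → (∀ i → b ≤ i → ¬ P i) →
                   ∀ {n} → P n → ∃ λ k → P k × (∀ i → k < i → ¬ P i)
greatest-witness         P? zero    none Pn = ⊥-elim (none _ z≤n Pn)
greatest-witness {P = P} P? (suc b) none Pn with P? b
... | yes Pb = b , Pb , none
... | no ¬Pb = greatest-witness P? b none′ Pn
  where
  none′ : ∀ i → b ≤ i → ¬ P i
  none′ i b≤i with m≤n⇒m<n∨m≡n b≤i
  ... | inj₁ b<i  = none i b<i
  ... | inj₂ refl = ¬Pb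

ceilDiv-≤ : ∀ {a w} k → 1 ≤ k → a ≤ k * w → ceilDiv a k ≤ w
ceilDiv-≤ {a} {w} (suc k) _ a≤ = ≤-pred (m<n*o⇒m/o<n {a + k} {suc w} {suc k} (begin-strict
  a + k              <⟨ +-monoʳ-< a (n<1+n k) ⟩
  a + suc k          ≤⟨ +-monoˡ-≤ (suc k) a≤ ⟩
  suc k * w + suc k  ≡⟨ trans (+-comm (suc k * w) (suc k)) (cong (suc k +_) (*-comm (suc k) w)) ⟩
  suc w * suc k      ∎))
  where open ≤-Reasoning

∣1+[+a-1]∣≡a : ∀ a → ∣ 1ℤ ℤ.+ (ℤ.+ a ℤ.- ℤ.+ 1) ∣ ≡ a
∣1+[+a-1]∣≡a zero    = refl
∣1+[+a-1]∣≡a (suc a) = refl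

+a-1≤+b-1⇒a≤b : ∀ {a b} → ℤ.+ a ℤ.- ℤ.+ 1 ℤ.≤ ℤ.+ b ℤ.- ℤ.+ 1 → a ≤ b
+a-1≤+b-1⇒a≤b {zero}              _  = z≤n
+a-1≤+b-1⇒a≤b {suc a} {zero}      ()
+a-1≤+b-1⇒a≤b {suc a} {suc b} (ℤ.+≤+ a≤b) = s≤s a≤b

becomesRed-red : ∀ {m} {X : Subset m} {prev : Fin m → Status} {v} →
                 v ∉ X → prev v ≡ red → becomesRed X prev v ≡ true
becomesRed-red v∉X red≡ rewrite ∉⇒lookup≡false v∉X | red≡ = refl

module _ (r s : ℕ) (H : Graph) (X : Subset (n H)) (prev : Fin (n H) → Status) {v : Fin (n H)} where

  step-immunized : v ∈ X → step r s H X prev v ≡ green r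
  step-immunized v∈X rewrite []=⇒lookup v∈X = refl

  step-red : v ∉ X → prev v ≡ red → step r s H X prev v ≡ red
  step-red v∉X red≡ rewrite ∉⇒lookup≡false v∉X | red≡ = refl

  step-countdown : ∀ {c} → v ∉ X → prev v ≡ green (suc (suc c)) →
                   step r s H X prev v ≡ green (suc c)
  step-countdown v∉X green≡ rewrite ∉⇒lookup≡false v∉X | green≡ = refl

  step-alarm : ∀ {u} → v ∉ X → prev v ≡ green 1 → Adj H v u ≡ true → becomesRed X prev u ≡ true →
               step r s H X prev v ≡ yellow s
  step-alarm {u} v∉X green≡ adj u-red
    rewrite ∉⇒lookup≡false v∉X | green≡
          | any-allFin (λ w → Adj H v w ∧ becomesRed X prev w) {u} (cong₂ _∧_ adj u-red) = refl

  step-not-green : v ∉ X → ¬ isGreen (prev v) → ¬ isGreen (step r s H X prev v)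
  step-not-green v∉X notGreen rewrite ∉⇒lookup≡false v∉X with prev v
  ... | red                  = λ ()
  ... | yellow zero          = λ ()
  ... | yellow (suc zero)    = λ ()
  ... | yellow (suc (suc _)) = λ ()
  ... | green _              = λ _ → notGreen _

module Run (H : Graph) (r s : ℕ) (J : Protocol (n H)) where

  -- immunized t is the paper's A_{t+1}; it is empty for t ≥ N.
  immunized : ℕ → Subset (n H)
  immunized t with t <? N J
  ... | yes t<N = A J (fromℕ< t<N)
  ... | no _    = ∅

  immunized-toℕ : ∀ i → immunized (toℕ i) ≡ A J i
  immunized-toℕ i with toℕ i <? N J
  ... | yes i<N = cong (A J) (fromℕ<-toℕ i i<N)
  ... | no i≮N  = ⊥-elim (i≮N (toℕ<n i))

  A-fromℕ< : ∀ {t} (t<N : t < N J) → A J (fromℕ< t<N) ≡ immunized t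
  A-fromℕ< t<N = trans (≡.sym (immunized-toℕ (fromℕ< t<N))) (cong immunized (toℕ-fromℕ< t<N))

  immunized⇒<N : ∀ {w t} → w ∈ immunized t → t < N J
  immunized⇒<N {t = t} w∈ with t <? N J
  ... | yes t<N = t<N
  ... | no _    = ⊥-elim (∉⊥ w∈)

  ∣immunized∣≤width : ∀ t → size (immunized t) ≤ protocolWidth J
  ∣immunized∣≤width t with t <? N J
  ... | yes t<N = tabulate-⊔-upperBound size (A J) (fromℕ< t<N)
  ... | no _    = ≤-trans (≤-reflexive (∣⊥∣≡0 (n H))) z≤n

  status : ℕ → Fin (n H) → Status
  status zero    = λ _ → red
  status (suc t) = step r s H (immunized t) (status t)

  foldl-step≡status : ∀ m (f : Fin m → Subset (n H)) t → (∀ i → f i ≡ immunized (t + toℕ i)) →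
               foldl (λ st X → step r s H X st) (status t) (tabulate f) ≡ status (t + m)
  foldl-step≡status zero    f t _  = cong status (≡.sym (+-identityʳ t))
  foldl-step≡status (suc m) f t f≡ = begin
    foldl next (step r s H (f fzero) (status t)) (tabulate (f ∘ fsuc))
      ≡⟨ cong (λ X → foldl next (step r s H X (status t)) (tabulate (f ∘ fsuc)))
              (trans (f≡ fzero) (cong immunized (+-identityʳ t))) ⟩
    foldl next (status (suc t)) (tabulate (f ∘ fsuc))
      ≡⟨ foldl-step≡status m (f ∘ fsuc) (suc t)
                    (λ i → trans (f≡ (fsuc i)) (cong immunized (+-suc t (toℕ i)))) ⟩
    status (suc t + m)
      ≡⟨ cong status (≡.sym (+-suc t m)) ⟩
    status (t + suc m) ∎
    where
    open ≡.≡-Reasoning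
    next : (Fin (n H) → Status) → Subset (n H) → Fin (n H) → Status
    next st X = step r s H X st

  cleared⇒green : Clears r s H J → ∀ w → isGreen (status (N J) w)
  cleared⇒green cleared w = subst (λ st → isGreen (st w)) finalStatus≡status (cleared w)
    where
    finalStatus≡status : finalStatus r s H J ≡ status (N J)
    finalStatus≡status = foldl-step≡status (N J) (A J) 0 (λ i → ≡.sym (immunized-toℕ i))

  FirstAt LastAt : Fin (n H) → ℕ → Set
  FirstAt w j = w ∈ immunized j × (∀ i → i < j → w ∉ immunized i)
  LastAt  w k = w ∈ immunized k × (∀ i → k < i → w ∉ immunized i)

  firstAt-exists : ∀ {w t} → w ∈ immunized t → ∃ (FirstAt w)
  firstAt-exists {w} = least-witness (λ t → w ∈? immunized t)

  lastAt-exists : ∀ {w t} → w ∈ immunized t → ∃ (LastAt w)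
  lastAt-exists {w} = greatest-witness (λ t → w ∈? immunized t) (N J)
                                       (λ i N≤i w∈i → <⇒≱ (immunized⇒<N w∈i) N≤i)

  firstAt-≤ : ∀ {w j t} → FirstAt w j → w ∈ immunized t → j ≤ t
  firstAt-≤ (_ , before) w∈t = ≮⇒≥ (λ t<j → before _ t<j w∈t)

  lastAt-≥ : ∀ {w k t} → LastAt w k → w ∈ immunized t → t ≤ k
  lastAt-≥ (_ , after) w∈t = ≮⇒≥ (λ k<t → after _ k<t w∈t)

  status-red : ∀ {v t} → (∀ i → i < t → v ∉ immunized i) → status t v ≡ red
  status-red {t = zero}  _     = refl
  status-red {t = suc t} fresh = step-red r s H (immunized t) (status t) (fresh t ≤-refl)
                                   (status-red (λ i i<t → fresh i (m<n⇒m<1+n i<t)))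

  status-countdown : ∀ {u k} → u ∈ immunized k → (∀ i → k < i → u ∉ immunized i) →
                     ∀ d c → d + suc c ≡ r → status (d + suc k) u ≡ green (suc c)
  status-countdown {k = k} u∈k _ zero c c+1≡r =
    trans (step-immunized r s H (immunized k) (status k) u∈k) (cong green (≡.sym c+1≡r))
  status-countdown {k = k} u∈k after (suc d) c d+c+2≡r =
    step-countdown r s H (immunized (d + suc k)) (status (d + suc k))
      (after (d + suc k) (m≤n+m (suc k) d))
      (status-countdown u∈k after d (suc c) (trans (+-suc d (suc c)) d+c+2≡r))

  status-stays-not-green : ∀ {u t} → (∀ i → t ≤ i → u ∉ immunized i) → ¬ isGreen (status t u) →
                           ∀ d → ¬ isGreen (status (d + t) u)
  status-stays-not-green _ notGreen zero = notGreen
  status-stays-not-green {t = t} never notGreen (suc d) =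
    step-not-green r s H (immunized (d + t)) (status (d + t)) (never (d + t) (m≤n+m t d))
      (status-stays-not-green never notGreen d)

  immunized-somewhere : Clears r s H J → ∀ w → ∃ λ t → w ∈ immunized t
  immunized-somewhere cleared w with anyUpTo? (λ t → w ∈? immunized t) (N J)
  ... | yes (t , _ , w∈t) = t , w∈t
  ... | no never = ⊥-elim (subst isGreen (status-red (λ i i<N w∈i → never (i , i<N , w∈i)))
                                          (cleared⇒green cleared w))

  neighbour-firstAt-≤ : Clears r s H J → 1 ≤ r → ∀ {u v k j} → Adj H u v ≡ true →
                        LastAt u k → FirstAt v j → j ≤ k + r
  neighbour-firstAt-≤ cleared r≥1 {u} {v} {k} {j} adj (u∈k , after) (v∈j , before) = ≮⇒≥ late⇒⊥
    where
    t : ℕ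
    t = k + r

    k<t : k < t
    k<t = m<m+n k r≥1

    u-green1 : status t u ≡ green 1
    u-green1 = subst (λ x → status x u ≡ green 1) r-1+[k+1]≡t
                 (status-countdown u∈k after (r ∸ 1) 0 (m∸n+n≡m r≥1))
      where
      open ≡.≡-Reasoning
      r-1+[k+1]≡t : r ∸ 1 + suc k ≡ t
      r-1+[k+1]≡t = begin
        r ∸ 1 + suc k    ≡⟨ +-suc (r ∸ 1) k ⟩
        suc (r ∸ 1) + k  ≡⟨ cong (_+ k) (m+[n∸m]≡n r≥1) ⟩
        r + k            ≡⟨ +-comm r k ⟩
        k + r            ∎

    late⇒⊥ : ¬ (t < j)
    late⇒⊥ t<j = status-stays-not-green (λ i t<i → after i (<-trans k<t t<i)) u-not-green
                   (N J ∸ suc t)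
                   (subst (λ x → isGreen (status x u)) (≡.sym (m∸n+n≡m t<N))
                          (cleared⇒green cleared u))
      where
      t<N : t < N J
      t<N = <-trans t<j (immunized⇒<N v∈j)

      v-red : status t v ≡ red
      v-red = status-red (λ i i<t → before i (<-trans i<t t<j))

      u-yellow : status (suc t) u ≡ yellow s
      u-yellow = step-alarm r s H (immunized t) (status t) (after t k<t) u-green1 adj
                   (becomesRed-red (before t t<j) v-red)

      u-not-green : ¬ isGreen (status (suc t) u)
      u-not-green isGreen-u = subst isGreen u-yellow isGreen-u

  window : ℕ → ℕ → Subset (n H)
  window t zero    = ∅
  window t (suc l) = immunized t ∪ window (suc t) l

  ∈-window⁺ : ∀ {w t i} l → t ≤ i → i < t + l → w ∈ immunized i → w ∈ window t l
  ∈-window⁺ {t = t} zero t≤i i<t+0 _ =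
    ⊥-elim (<-irrefl (≡.sym (+-identityʳ t)) (≤-<-trans t≤i i<t+0))
  ∈-window⁺ {t = t} {i} (suc l) t≤i i<t+l+1 w∈i with m≤n⇒m<n∨m≡n t≤i
  ... | inj₂ refl = x∈p∪q⁺ (inj₁ w∈i)
  ... | inj₁ t<i  = x∈p∪q⁺ (inj₂ (∈-window⁺ l t<i (subst (i <_) (+-suc t l) i<t+l+1) w∈i))

  ∈-window⁻ : ∀ {w} t l → w ∈ window t l → ∃ λ i → t ≤ i × i < t + l × w ∈ immunized i
  ∈-window⁻ t zero    w∈ = ⊥-elim (∉⊥ w∈)
  ∈-window⁻ t (suc l) w∈ with x∈p∪q⁻ (immunized t) (window (suc t) l) w∈
  ... | inj₁ w∈t    = t , ≤-refl , m<m+n t z<s , w∈t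
  ... | inj₂ w∈rest with ∈-window⁻ (suc t) l w∈rest
  ...   | i , t<i , i< , w∈i = i , <⇒≤ t<i , subst (i <_) (≡.sym (+-suc t l)) i< , w∈i

  ∣window∣≤ : ∀ t l → size (window t l) ≤ l * protocolWidth J
  ∣window∣≤ t zero    = ≤-reflexive (∣⊥∣≡0 (n H))
  ∣window∣≤ t (suc l) = ≤-trans (∣p∪q∣≤∣p∣+∣q∣ (immunized t) (window (suc t) l))
                                (+-mono-≤ (∣immunized∣≤width t) (∣window∣≤ (suc t) l))

  cautious-window : Cautious r s H J → ∀ {w j k t} → FirstAt w j → LastAt w k →
                    j ≤ t → t + (r + s) ≤ suc k → w ∈ window t (r + s)
  cautious-window (_ , cautious) {w} {j} {k} {t} first last j≤t t+r+s≤k+1 =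
    let (i , t≤i , i< , w∈i) = cautious w (fromℕ< j<N) (fromℕ< k<N) isFirst isLast t
                                 (subst (_≤ t) (≡.sym (toℕ-fromℕ< j<N)) j≤t)
                                 (subst (λ x → t + (r + s) ≤ suc x) (≡.sym (toℕ-fromℕ< k<N))
                                        t+r+s≤k+1)
    in ∈-window⁺ (r + s) t≤i i< (subst (w ∈_) (≡.sym (immunized-toℕ i)) w∈i)
    where
    j<N : j < N J
    j<N = immunized⇒<N (proj₁ first)

    k<N : k < N J
    k<N = immunized⇒<N (proj₁ last)

    isFirst : IsFirst J w (fromℕ< j<N)
    isFirst = subst (w ∈_) (≡.sym (A-fromℕ< j<N)) (proj₁ first) ,
              λ i i<j w∈i → proj₂ first (toℕ i) (subst (toℕ i <_) (toℕ-fromℕ< j<N) i<j)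
                                        (subst (w ∈_) (≡.sym (immunized-toℕ i)) w∈i)

    isLast : IsLast J w (fromℕ< k<N)
    isLast = subst (w ∈_) (≡.sym (A-fromℕ< k<N)) (proj₁ last) ,
             λ i k<i w∈i → proj₂ last (toℕ i) (subst (_< toℕ i) (toℕ-fromℕ< k<N) k<i)
                                      (subst (w ∈_) (≡.sym (immunized-toℕ i)) w∈i)

  cautiousBag : ℕ → Subset (n H)
  cautiousBag t = window 0 (t + (r + s)) ∩ window t (N J)

  ∈-cautiousBag⁺ : ∀ {w t a b} → a < t + (r + s) → w ∈ immunized a → t ≤ b → w ∈ immunized b →
                   w ∈ cautiousBag t
  ∈-cautiousBag⁺ {t = t} a< w∈a t≤b w∈b =
    x∈p∩q⁺ ( ∈-window⁺ (t + (r + s)) z≤n a< w∈a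
           , ∈-window⁺ (N J) t≤b (<-≤-trans (immunized⇒<N w∈b) (m≤n+m (N J) t)) w∈b)

  ∈-cautiousBag⁻ : ∀ {w t} → w ∈ cautiousBag t →
                   ∃₂ λ a b → a < t + (r + s) × w ∈ immunized a × t ≤ b × w ∈ immunized b
  ∈-cautiousBag⁻ {t = t} w∈ =
    let (early , late)      = x∈p∩q⁻ (window 0 (t + (r + s))) (window t (N J)) w∈
        (a , _ , a< , w∈a)  = ∈-window⁻ 0 (t + (r + s)) early
        (b , t≤b , _ , w∈b) = ∈-window⁻ t (N J) late
    in a , b , a< , w∈a , t≤b , w∈b

  cautiousBag-consecutive : ∀ {w i j k} → i ≤ j → j ≤ k → w ∈ cautiousBag i → w ∈ cautiousBag k →
                            w ∈ cautiousBag j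
  cautiousBag-consecutive i≤j j≤k w∈i w∈k =
    let (a , _ , a< , w∈a , _)      = ∈-cautiousBag⁻ w∈i
        (_ , b , _ , _ , k≤b , w∈b) = ∈-cautiousBag⁻ w∈k
    in ∈-cautiousBag⁺ (<-≤-trans a< (+-monoˡ-≤ (r + s) i≤j)) w∈a (≤-trans j≤k k≤b) w∈b

  cautiousBag⊆window : Cautious r s H J → ∀ t → cautiousBag t ⊆ window t (r + s)
  cautiousBag⊆window cautious t w∈ with ∈-cautiousBag⁻ w∈
  ... | a , b , a< , w∈a , t≤b , w∈b with t ≤? a | t + (r + s) ≤? b
  ...   | yes t≤a | _           = ∈-window⁺ (r + s) t≤a a< w∈a
  ...   | no _    | no b<t+r+s  = ∈-window⁺ (r + s) t≤b (≰⇒> b<t+r+s) w∈b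
  ...   | no a<t  | yes t+r+s≤b =
    let (_ , first) = firstAt-exists w∈a
        (_ , last)  = lastAt-exists w∈b
    in cautious-window cautious first last
         (≤-trans (firstAt-≤ first w∈a) (<⇒≤ (≰⇒> a<t)))
         (m≤n⇒m≤1+n (≤-trans t+r+s≤b (lastAt-≥ last w∈b)))

  ∈-cautiousBag-⊓ : Clears r s H J → 1 ≤ r → 1 ≤ s → ∀ {w x j k k′} → Adj H x w ≡ true →
                    FirstAt w j → LastAt w k → LastAt x k′ → w ∈ cautiousBag (k ⊓ k′)
  ∈-cautiousBag-⊓ cleared r≥1 s≥1 {j = j} {k} {k′} adj first last last′ =
    ∈-cautiousBag⁺ j<k⊓k′+r+s (proj₁ first) (m⊓n≤m k k′) (proj₁ last)
    where
    j<k⊓k′+r+s : j < k ⊓ k′ + (r + s)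
    j<k⊓k′+r+s = subst (j <_) (≡.sym (+-distribʳ-⊓ (r + s) k k′)) (⊓-glb
      (≤-<-trans (firstAt-≤ first (proj₁ last)) (m<m+n k (≤-trans r≥1 (m≤m+n r s))))
      (≤-<-trans (neighbour-firstAt-≤ cleared r≥1 adj last′ first) (+-monoʳ-< k′ (m<m+n r s≥1))))

  cautiousDecomposition : Clears r s H J → 1 ≤ r → 1 ≤ s → PathDecomposition H
  cautiousDecomposition cleared r≥1 s≥1 = record
    { m'          = N J
    ; bag         = cautiousBag ∘ toℕ
    ; edgeCovered = edges-covered
    ; consecutive = λ _ _ _ _ → cautiousBag-consecutive
    }
    where
    edges-covered : ∀ u v → Adj H u v ≡ true →
                    ∃ λ i → u ∈ cautiousBag (toℕ i) × v ∈ cautiousBag (toℕ i)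
    edges-covered u v adj =
      let (_ , u∈)     = immunized-somewhere cleared u
          (_ , v∈)     = immunized-somewhere cleared v
          (ku , lastU) = lastAt-exists u∈
          (kv , lastV) = lastAt-exists v∈
          t<N+1 : ku ⊓ kv < suc (N J)
          t<N+1 = s≤s (≤-trans (m⊓n≤m ku kv) (<⇒≤ (immunized⇒<N (proj₁ lastU))))
          u∈t : u ∈ cautiousBag (ku ⊓ kv)
          u∈t = ∈-cautiousBag-⊓ cleared r≥1 s≥1 (sym H u v adj)
                  (proj₂ (firstAt-exists u∈)) lastU lastV
          v∈t : v ∈ cautiousBag (ku ⊓ kv)
          v∈t = subst (λ t → v ∈ cautiousBag t) (⊓-comm kv ku)
                  (∈-cautiousBag-⊓ cleared r≥1 s≥1 adj (proj₂ (firstAt-exists v∈)) lastV lastU)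
      in fromℕ< t<N+1 , subst (λ t → u ∈ cautiousBag t) (≡.sym (toℕ-fromℕ< t<N+1)) u∈t
                      , subst (λ t → v ∈ cautiousBag t) (≡.sym (toℕ-fromℕ< t<N+1)) v∈t

  maxBag-cautiousDecomposition : (cleared : Clears r s H J) (r≥1 : 1 ≤ r) (s≥1 : 1 ≤ s) →
    Cautious r s H J →
    maxBag (cautiousDecomposition cleared r≥1 s≥1) ≤ (r + s) * protocolWidth J
  maxBag-cautiousDecomposition _ _ _ cautious =
    tabulate-⊔-lub {m = suc (N J)} size (cautiousBag ∘ toℕ) λ i →
      ≤-trans (p⊆q⇒∣p∣≤∣q∣ (cautiousBag⊆window cautious (toℕ i))) (∣window∣≤ (toℕ i) (r + s))

open Run using (cautiousDecomposition; maxBag-cautiousDecomposition)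

theorem3p10 : (H : Graph) (r s : ℕ) → 1 ≤ r → 1 ≤ s →
    (J : Protocol (n H)) → Clears r s H J → Cautious r s H J →
    (p : ℤ) → IsPathwidth H p →
    ceilDiv ∣ 1ℤ ℤ.+ p ∣ (r + s) ≤ protocolWidth J
theorem3p10 H r s r≥1 s≥1 J cleared cautious .(pdWidth D) ((D , refl) , minimal) =
  ceilDiv-≤ (r + s) (≤-trans r≥1 (m≤m+n r s)) (begin
    ∣ 1ℤ ℤ.+ pdWidth D ∣       ≡⟨ ∣1+[+a-1]∣≡a (maxBag D) ⟩
    maxBag D                  ≤⟨ +a-1≤+b-1⇒a≤b (minimal D′) ⟩
    maxBag D′                 ≤⟨ maxBag-cautiousDecomposition H r s J cleared r≥1 s≥1 cautious ⟩
    (r + s) * protocolWidth J ∎)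
  where
  open ≤-Reasoning
  D′ : PathDecomposition H
  D′ = cautiousDecomposition H r s J cleared r≥1 s≥1
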